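{- Let $G$ be a connected graph of order $n\ge 2$ with $V(G)=\{u_1,\ldots,u_n\}$ and let $\mathcal{H}=\{H_1,\ldots,H_n\}$ be a family of $n$ non-trivial graphs. Let $k\in\{1,\ldots,\min\{\mathcal{T}(G\circ\mathcal{H}),\mathcal{C}(\mathcal{H})\}\}$. If $\operatorname{adim}_k(H_i)-\Delta(H_i)\ge\lceil k/2\rceil$ for every $H_i\in\mathcal{H}$, then $(G,\mathcal{H},k)$ satisfies Properties $\mathcal{P}_1$ and $\mathcal{P}_4$.
   Context: Graphs are finite and simple; non-trivial means at least two vertices; $\delta,\Delta$ minimum/maximum degree. Lexicographic product $G\circ\mathcal{H}$: vertex set $\bigcup_i\{u_i\}\times V(H_i)$, $(u_i,v)\sim(u_j,w)$ iff $u_iu_j\in E(G)$, or $i=j$ and $vw\in E(H_i)$. For a graph $H$, $S$ is a $k$-adjacency generator if every two distinct $x,y$ satisfy $|((N_H(x)\triangledown N_H(y))\cup\{x,y\})\cap S|\ge k$; $\operatorname{adim}_k(H)$ is its minimum cardinality; a $k$-adjacency basis is one of that size. $\mathcal{C}(H)=\min_{x\neq y}|(N_H(x)\triangledown N_H(y))\cup\{x,y\}|$, $\mathcal{C}(\mathcal{H})=\min_i\mathcal{C}(H_i)$. Distinct $x,y\in V(G)$ are true twins if $N[x]=N[y]$, false twins if $N(x)=N(y)$; the relation $N(x)-\{y\}=N(y)-\{x\}$ partitions $V(G)$ into singleton, false twin and true twin classes with unions $S(G),FT(G),TT(G)$; $FT(u_i),TT(u_i)$ is the class of $u_i$. $\mathcal{T}(u_i,\mathcal{H})=|V(H_i)|$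 if $u_i\in S(G)$; $=\min\{\delta(H_j)+\delta(H_l)+2: u_j,u_l\in FT(u_i), j\neq l\}$ if $u_i\in FT(G)$; $=\min\{|V(H_j)|-\Delta(H_j)+|V(H_l)|-\Delta(H_l): u_j,u_l\in TT(u_i), j\neq l\}$ if $u_i\in TT(G)$; $\mathcal{T}(G\circ\mathcal{H})=\min_{u_i}\mathcal{T}(u_i,\mathcal{H})$. Property $\mathcal{P}_1$: for every $u_i\in TT(G)$ with $TT(u_i)=\{u_{i_1},\ldots,u_{i_r}\}$ there exist $k$-adjacency bases $A_{i_1},\ldots,A_{i_r}$ of $H_{i_1},\ldots,H_{i_r}$ such that for all $j\neq l$, all $x\in V(H_{i_j})$, $y\in V(H_{i_l})$: $|(A_{i_j}\cap(V(H_{i_j})-N_{H_{i_j}}(x)))\cup(A_{i_l}\cap(V(H_{i_l})-N_{H_{i_l}}(y)))|\ge k$. Property $\mathcal{P}_4$: the same condition, but for every $u_i\in FT(G)$ with the class $FT(u_i)=\{u_{i_1},\ldots,u_{i_r}\}$. -}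

module Defs where

open import Data.Nat using (ℕ; zero; suc; _+_; _≤_; _⊓_; _⊔_)
open import Data.Bool using (Bool; true; false; _xor_; if_then_else_)
import Data.Bool as Bool
open import Data.Fin using (Fin; _≟_)
open import Data.Fin.Subset using (Subset; _∩_; _∪_; ∁; ⁅_⁆; ∣_∣; _-_)
open import Data.Fin.Properties using (any?)
open import Data.Vec using (tabulate; zipWith)
open import Data.Vec.Properties using (≡-dec)
open import Data.List using (List; []; _∷_; map; foldr; filter; cartesianProduct)
open import Data.List.Base using (allFin)
open import Data.Product using (Σ; ∃; _×_; _,_; proj₁; proj₂)
open import Relation.Nullary using (¬_; Dec; does; ¬?)
open import Relation.Nullary.Decidable using (_×-dec_)
open import Relation.Binary.PropositionalEquality using (_≡_; _≢_)

record Graph : Set where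
  field
    ord    : ℕ
    adj    : Fin ord → Fin ord → Bool
    sym    : ∀ x y → adj x y ≡ adj y x
    irrefl : ∀ x → adj x x ≡ false
open Graph public

V : (H : Graph) → Subset (ord H)
V H = tabulate (λ _ → true)

N : (H : Graph) → Fin (ord H) → Subset (ord H)
N H x = tabulate (adj H x)

deg : (H : Graph) → Fin (ord H) → ℕ
deg H x = ∣ N H x ∣

infixr 6 _▽_
_▽_ : ∀ {m} → Subset m → Subset m → Subset m
_▽_ = zipWith _xor_

-- minimum / maximum of a list of naturals (the lists used below are nonempty)
minL : List ℕ → ℕ
minL []       = 0
minL (x ∷ xs) = foldr _⊓_ x xs

maxL : List ℕ → ℕ
maxL = foldr _⊔_ 0

distinctPairs : ∀ {m} → List (Fin m) → List (Fin m × Fin m)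
distinctPairs xs = filter (λ p → ¬? (proj₁ p ≟ proj₂ p)) (cartesianProduct xs xs)

δ : Graph → ℕ
δ H = minL (map (deg H) (allFin (ord H)))

Δ : Graph → ℕ
Δ H = maxL (map (deg H) (allFin (ord H)))

data Walk (G : Graph) : Fin (ord G) → Fin (ord G) → Set where
  here : ∀ {x} → Walk G x x
  step : ∀ {x y z} → adj G x y ≡ true → Walk G y z → Walk G x z

Connected : Graph → Set
Connected G = ∀ x y → Walk G x y

NonTrivial : Graph → Set
NonTrivial H = 2 ≤ ord H

distSet : (H : Graph) → Fin (ord H) → Fin (ord H) → Subset (ord H)
distSet H x y = (N H x ▽ N H y) ∪ ⁅ x ⁆ ∪ ⁅ y ⁆

IsKAdjGen : ℕ → (H : Graph) → Subset (ord H) → Set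
IsKAdjGen k H S = ∀ x y → x ≢ y → k ≤ ∣ distSet H x y ∩ S ∣

IsAdim : ℕ → (H : Graph) → ℕ → Set
IsAdim k H d = (Σ (Subset (ord H)) λ S → IsKAdjGen k H S × ∣ S ∣ ≡ d)
             × (∀ S → IsKAdjGen k H S → d ≤ ∣ S ∣)

IsKAdjBasis : ℕ → (H : Graph) → Subset (ord H) → Set
IsKAdjBasis k H A = IsKAdjGen k H A × (∀ S → IsKAdjGen k H S → ∣ A ∣ ≤ ∣ S ∣)

Cgraph : Graph → ℕ
Cgraph H = minL (map (λ p → ∣ distSet H (proj₁ p) (proj₂ p) ∣) (distinctPairs (allFin (ord H))))

Cfam : (G : Graph) → (Fin (ord G) → Graph) → ℕ
Cfam G H = minL (map (λ i → Cgraph (H i)) (allFin (ord G)))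

Twin : (G : Graph) → Fin (ord G) → Fin (ord G) → Set
Twin G x y = (N G x - y) ≡ (N G y - x)

twin? : (G : Graph) → ∀ x y → Dec (Twin G x y)
twin? G x y = ≡-dec Bool._≟_ (N G x - y) (N G y - x)

InFT : (G : Graph) → Fin (ord G) → Set
InFT G u = ∃ λ v → v ≢ u × Twin G u v × adj G u v ≡ false

InTT : (G : Graph) → Fin (ord G) → Set
InTT G u = ∃ λ v → v ≢ u × Twin G u v × adj G u v ≡ true

inFT? : (G : Graph) → ∀ u → Dec (InFT G u)
inFT? G u = any? (λ v → ¬? (v ≟ u) ×-dec twin? G u v ×-dec (adj G u v Bool.≟ false))

inTT? : (G : Graph) → ∀ u → Dec (InTT G u)
inTT? G u = any? (λ v → ¬? (v ≟ u) ×-dec twin? G u v ×-dec (adj G u v Bool.≟ true))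

twinClass : (G : Graph) → Fin (ord G) → List (Fin (ord G))
twinClass G u = filter (twin? G u) (allFin (ord G))

Tvertex : (G : Graph) → (Fin (ord G) → Graph) → Fin (ord G) → ℕ
Tvertex G H i =
  if does (inFT? G i)
  then minL (map (λ p → δ (H (proj₁ p)) + δ (H (proj₂ p)) + 2) (distinctPairs (twinClass G i)))
  else (if does (inTT? G i)
        then minL (map (λ p → (ord (H (proj₁ p)) Data.Nat.∸ Δ (H (proj₁ p)))
                            + (ord (H (proj₂ p)) Data.Nat.∸ Δ (H (proj₂ p))))
                       (distinctPairs (twinClass G i)))
        else ord (H i))

Tlex : (G : Graph) → (Fin (ord G) → Graph) → ℕ
Tlex G H = minL (map (Tvertex G H) (allFin (ord G)))

-- Properties P1 and P4.  The union in the paper is of subsets of the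
-- disjoint vertex sets {u_j}×V(H_j) and {u_l}×V(H_l) of G∘𝓗, so its
-- cardinality is the sum of the two cardinalities.

ClassCondition : ℕ → (G : Graph) → (Fin (ord G) → Graph) → Fin (ord G) → Set
ClassCondition k G H i =
  Σ ((j : Fin (ord G)) → Subset (ord (H j))) λ A →
      (∀ j → Twin G i j → IsKAdjBasis k (H j) (A j))
    × (∀ j l → Twin G i j → Twin G i l → j ≢ l →
         ∀ (x : Fin (ord (H j))) (y : Fin (ord (H l))) →
           k ≤ ∣ A j ∩ ∁ (N (H j) x) ∣ + ∣ A l ∩ ∁ (N (H l) y) ∣)

P1 : ℕ → (G : Graph) → (Fin (ord G) → Graph) → Set
P1 k G H = ∀ i → InTT G i → ClassCondition k G H i

P4 : ℕ → (G : Graph) → (Fin (ord G) → Graph) → Set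
P4 k G H = ∀ i → InFT G i → ClassCondition k G H i

-- A k-adjacency basis A of H has at least Δ(H) + ⌈k/2⌉ vertices, and at most
-- Δ(H) of them are neighbours of any given vertex x, so at least ⌈k/2⌉ of them
-- lie outside N(x). Two such counts, taken in different graphs of the family,
-- add up to at least k. Bases exist because V(H) is itself a k-adjacency
-- generator when k ≤ C(H). Neither the twin structure of G nor the hypotheses
-- on G, on 1 ≤ k and on 𝒯 play a role: any choice of bases witnesses both
-- properties.
module Submission where

open import Defs hiding (sym)
open import Level using (Level)
open import Data.Bool using (true)
open import Data.Nat using (ℕ; suc; _≤_; _<_; _+_; _⊓_; ⌈_/2⌉; _≤?_)
open import Data.Nat.Properties
  using (≤-refl; ≤-trans; m⊓n≤m; m⊓n≤n; m≤m⊔n; m≤n⊔m; ≮⇒≥; +-suc; +-mono-≤;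
         +-monoˡ-≤; +-cancelˡ-≤; module ≤-Reasoning; ⌊n/2⌋≤⌈n/2⌉; ⌊n/2⌋+⌈n/2⌉≡n)
open import Data.Nat.Induction using (<-wellFounded)
open import Induction.WellFounded using (Acc; acc)
open import Data.Fin using (Fin; _≟_)
open import Data.Fin.Subset using (Subset; ⊤; _∩_; ∁; ∣_∣; inside; outside)
open import Data.Fin.Subset.Properties using (anySubset?; ∣p∩q∣≤∣q∣; ∩-identityʳ)
open import Data.Fin.Properties using (all?)
open import Data.Vec using ([]; _∷_; tabulate; lookup)
open import Data.Vec.Properties using (tabulate-cong; tabulate∘lookup; lookup-replicate)
open import Data.List using ([]; _∷_; foldr)
open import Data.List.Membership.Propositional using (_∈_)
open import Data.List.Membership.Propositional.Properties
  using (∈-map⁺; ∈-filter⁺; ∈-cartesianProduct⁺; ∈-allFin)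
open import Data.List.Relation.Unary.Any using (here; there)
open import Data.Product using (Σ; ∃; _×_; _,_; proj₁; proj₂)
open import Relation.Nullary using (yes; no; ¬?)
open import Relation.Nullary.Decidable using (_→-dec_; _×-dec_)
open import Relation.Unary using (Pred; Decidable)
open import Relation.Binary.PropositionalEquality
  using (_≡_; _≢_; refl; sym; trans; cong; subst; module ≡-Reasoning)

private
  variable
    ℓ : Level
    n : ℕ

foldr-⊓-≤-seed : ∀ x xs → foldr _⊓_ x xs ≤ x
foldr-⊓-≤-seed x []       = ≤-refl
foldr-⊓-≤-seed x (y ∷ ys) = ≤-trans (m⊓n≤n y _) (foldr-⊓-≤-seed x ys)

foldr-⊓-≤ : ∀ {z} x xs → z ∈ xs → foldr _⊓_ x xs ≤ z
foldr-⊓-≤ x (y ∷ ys) (here refl) = m⊓n≤m y _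
foldr-⊓-≤ x (y ∷ ys) (there z∈ys) = ≤-trans (m⊓n≤n y _) (foldr-⊓-≤ x ys z∈ys)

minL-≤ : ∀ {z} xs → z ∈ xs → minL xs ≤ z
minL-≤ (x ∷ xs) (here refl)  = foldr-⊓-≤-seed x xs
minL-≤ (x ∷ xs) (there z∈xs) = foldr-⊓-≤ x xs z∈xs

≤-maxL : ∀ {z} xs → z ∈ xs → z ≤ maxL xs
≤-maxL (x ∷ xs) (here refl)  = m≤m⊔n x _
≤-maxL (x ∷ xs) (there z∈xs) = ≤-trans (≤-maxL xs z∈xs) (m≤n⊔m x _)

∣p∣≡∣p∩q∣+∣p∩∁q∣ : (p q : Subset n) → ∣ p ∣ ≡ ∣ p ∩ q ∣ + ∣ p ∩ ∁ q ∣
∣p∣≡∣p∩q∣+∣p∩∁q∣ []            []            = refl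
∣p∣≡∣p∩q∣+∣p∩∁q∣ (outside ∷ p) (_ ∷ q)       = ∣p∣≡∣p∩q∣+∣p∩∁q∣ p q
∣p∣≡∣p∩q∣+∣p∩∁q∣ (inside ∷ p)  (inside ∷ q)  = cong suc (∣p∣≡∣p∩q∣+∣p∩∁q∣ p q)
∣p∣≡∣p∩q∣+∣p∩∁q∣ (inside ∷ p)  (outside ∷ q) =
  trans (cong suc (∣p∣≡∣p∩q∣+∣p∩∁q∣ p q)) (sym (+-suc ∣ p ∩ q ∣ ∣ p ∩ ∁ q ∣))

minimumSubset : {P : Pred (Subset n) ℓ} → Decidable P → (S : Subset n) → P S →
                ∃ λ A → P A × (∀ T → P T → ∣ A ∣ ≤ ∣ T ∣)
minimumSubset {P = P} P? S PS = go S (<-wellFounded ∣ S ∣) PS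
  where
  go : (S : Subset _) → Acc _<_ ∣ S ∣ → P S → ∃ λ A → P A × (∀ T → P T → ∣ A ∣ ≤ ∣ T ∣)
  go S (acc smaller) PS with anySubset? (λ T → P? T ×-dec (suc ∣ T ∣ ≤? ∣ S ∣))
  ... | yes (T , PT , T<S) = go T (smaller T<S) PT
  ... | no  ¬T<S           = S , PS , λ T PT → ≮⇒≥ (λ T<S → ¬T<S (T , PT , T<S))

V≡⊤ : (H : Graph) → V H ≡ ⊤
V≡⊤ H = begin
  tabulate (λ _ → true)          ≡⟨ tabulate-cong (λ i → sym (lookup-replicate i inside)) ⟩
  tabulate (lookup ⊤)            ≡⟨ tabulate∘lookup ⊤ ⟩
  ⊤                              ∎
  where open ≡-Reasoning

deg≤Δ : (H : Graph) (x : Fin (ord H)) → deg H x ≤ Δ H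
deg≤Δ H x = ≤-maxL _ (∈-map⁺ (deg H) (∈-allFin x))

Cgraph≤∣distSet∣ : (H : Graph) {x y : Fin (ord H)} → x ≢ y → Cgraph H ≤ ∣ distSet H x y ∣
Cgraph≤∣distSet∣ H {x} {y} x≢y =
  minL-≤ _ (∈-map⁺ (λ p → ∣ distSet H (proj₁ p) (proj₂ p) ∣)
    (∈-filter⁺ (λ p → ¬? (proj₁ p ≟ proj₂ p))
      (∈-cartesianProduct⁺ (∈-allFin x) (∈-allFin y)) x≢y))

Cfam≤Cgraph : (G : Graph) (H : Fin (ord G) → Graph) (i : Fin (ord G)) → Cfam G H ≤ Cgraph (H i)
Cfam≤Cgraph G H i = minL-≤ _ (∈-map⁺ (λ j → Cgraph (H j)) (∈-allFin i))

isKAdjGen? : ∀ k (H : Graph) → Decidable (IsKAdjGen k H)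
isKAdjGen? k H S = all? λ x → all? λ y → ¬? (x ≟ y) →-dec (k ≤? ∣ distSet H x y ∩ S ∣)

V-isKAdjGen : ∀ {k} (H : Graph) → k ≤ Cgraph H → IsKAdjGen k H (V H)
V-isKAdjGen {k} H k≤C x y x≢y = begin
  k                              ≤⟨ k≤C ⟩
  Cgraph H                       ≤⟨ Cgraph≤∣distSet∣ H x≢y ⟩
  ∣ distSet H x y ∣              ≡⟨ cong ∣_∣ (sym (∩-identityʳ (distSet H x y))) ⟩
  ∣ distSet H x y ∩ ⊤ ∣          ≡⟨ cong (λ S → ∣ distSet H x y ∩ S ∣) (sym (V≡⊤ H)) ⟩
  ∣ distSet H x y ∩ V H ∣        ∎
  where open ≤-Reasoning

kAdjBasis-exists : ∀ {k} (H : Graph) → k ≤ Cgraph H → Σ (Subset (ord H)) (IsKAdjBasis k H)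
kAdjBasis-exists {k} H k≤C = minimumSubset (isKAdjGen? k H) (V H) (V-isKAdjGen H k≤C)

kAdjBasis⇒IsAdim : ∀ {k} {H : Graph} {A : Subset (ord H)} → IsKAdjBasis k H A → IsAdim k H ∣ A ∣
kAdjBasis⇒IsAdim {A = A} (gen , minimal) = (A , gen , refl) , minimal

∣A∣≤Δ+∣A∩∁N∣ : (H : Graph) (A : Subset (ord H)) (x : Fin (ord H)) → ∣ A ∣ ≤ Δ H + ∣ A ∩ ∁ (N H x) ∣
∣A∣≤Δ+∣A∩∁N∣ H A x = begin
  ∣ A ∣                                  ≡⟨ ∣p∣≡∣p∩q∣+∣p∩∁q∣ A (N H x) ⟩
  ∣ A ∩ N H x ∣ + ∣ A ∩ ∁ (N H x) ∣      ≤⟨ +-monoˡ-≤ _ (∣p∩q∣≤∣q∣ A (N H x)) ⟩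
  deg H x + ∣ A ∩ ∁ (N H x) ∣            ≤⟨ +-monoˡ-≤ _ (deg≤Δ H x) ⟩
  Δ H + ∣ A ∩ ∁ (N H x) ∣                ∎
  where open ≤-Reasoning

large⇒⌈k/2⌉≤∣A∩∁N∣ : ∀ {k} (H : Graph) (A : Subset (ord H)) → Δ H + ⌈ k /2⌉ ≤ ∣ A ∣ →
                     (x : Fin (ord H)) → ⌈ k /2⌉ ≤ ∣ A ∩ ∁ (N H x) ∣
large⇒⌈k/2⌉≤∣A∩∁N∣ H A large x = +-cancelˡ-≤ (Δ H) _ _ (≤-trans large (∣A∣≤Δ+∣A∩∁N∣ H A x))

n≤⌈n/2⌉+⌈n/2⌉ : ∀ n → n ≤ ⌈ n /2⌉ + ⌈ n /2⌉
n≤⌈n/2⌉+⌈n/2⌉ n = subst (_≤ ⌈ n /2⌉ + ⌈ n /2⌉) (⌊n/2⌋+⌈n/2⌉≡n n) (+-monoˡ-≤ ⌈ n /2⌉ (⌊n/2⌋≤⌈n/2⌉ n))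

classCondition : ∀ {k} (G : Graph) (H : Fin (ord G) → Graph) (A : ∀ j → Subset (ord (H j))) →
                 (∀ j → IsKAdjBasis k (H j) (A j)) → (∀ j → Δ (H j) + ⌈ k /2⌉ ≤ ∣ A j ∣) →
                 ∀ i → ClassCondition k G H i
classCondition {k} G H A basis large i = A , (λ j _ → basis j) , λ j l _ _ _ x y →
  ≤-trans (n≤⌈n/2⌉+⌈n/2⌉ k)
          (+-mono-≤ (large⇒⌈k/2⌉≤∣A∩∁N∣ (H j) (A j) (large j) x)
                    (large⇒⌈k/2⌉≤∣A∩∁N∣ (H l) (A l) (large l) y))

lemma15 : (G : Graph) → (H : Fin (ord G) → Graph) → (k : ℕ)
          → 2 ≤ ord G → Connected G
          → (∀ i → NonTrivial (H i))
          → 1 ≤ k → k ≤ Tlex G H → k ≤ Cfam G H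
          → (∀ i d → IsAdim k (H i) d → Δ (H i) + ⌈ k /2⌉ ≤ d)
          → P1 k G H × P4 k G H
lemma15 G H k _ _ _ _ _ k≤C adim-large =
  (λ i _ → classCondition G H A basis large i) , (λ i _ → classCondition G H A basis large i)
  where
  bases : ∀ j → Σ (Subset (ord (H j))) (IsKAdjBasis k (H j))
  bases j = kAdjBasis-exists (H j) (≤-trans k≤C (Cfam≤Cgraph G H j))

  A : ∀ j → Subset (ord (H j))
  A j = proj₁ (bases j)

  basis : ∀ j → IsKAdjBasis k (H j) (A j)
  basis j = proj₂ (bases j)

  large : ∀ j → Δ (H j) + ⌈ k /2⌉ ≤ ∣ A j ∣
  large j = adim-large j ∣ A j ∣ (kAdjBasis⇒IsAdim {H = H j} (basis j))
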